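{- Let $G$ be a graph with spanning tree $T$, and suppose there is an acyclic charging scheme from $G$ to $T$ of value $v$. Then for any $\epsilon>0$ and any nonnegative edge weighting $w$ on $G$, the greedy algorithm below outputs a $(1+\epsilon)$-spanner $G'$ of $G$ containing $T$ with $w(G')\le (1+v/\epsilon)\cdot w(T)$. The algorithm: set $G'=T$; for each edge $e=\{a,b\}\in G-T$ in nondecreasing order of $w(e)$, if $(1+\epsilon)w(e)<d_{G'}(a,b)$ then add $e$ to $G'$; return $G'$.
   Context: $d_H(a,b)$ denotes the shortest-path distance in a weighted graph $H$; a spanning subgraph $G'$ of $G$ is a $(1+\epsilon)$-spanner if $d_{G'}(a,b)\le(1+\epsilon)d_G(a,b)$ for all vertices $a,b$; $w(\cdot)$ denotes total edge weight. A detour in $G$ is a pair $(e,P)$ of an edge $e$ and a path $P$ such that $e+P$ is a simple cycle. A charging scheme assigns $x_{(e,P)}\ge 0$ to each detour; the move subtracts $x_{(e,P)}$ units of charge from $e$ and adds $x_{(e,P)}$ units to each edge of $P$ ("$e$ charges $P$" when $x_{(e,P)}>0$). With $\mathrm{Out}(e)=\sum_P x_{(e,P)}$, $\mathrm{In}(e)=\sum_{(e',P):\,e\in P}x_{(e',P)}$ and $\mathrm{Net}(e)=\mathrm{In}(e)-\mathrm{Out}(e)$, a charging scheme from $G$ to $T$ of value $v$ satisfies (1) $\mathrm{Out}(e)\ge1$ for $e\in G-T$; (2) $\mathrm{Net}(e)\le 0$ for $e\in G-T$; (3) $\mathrm{Net}(e)\le v$ for $e\in T$. It is acyclic if also (4)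 only edges of $G-T$ charge paths, and (5) there is an ordering of the edges such that whenever $e_1$ charges a path containing $e_2$, $e_1$ precedes $e_2$.
   Formalization: The edge weights w, the parameter ε, the value v of the charging scheme and the charging amounts $x_{(e,P)}$ all take rational values. -}

module Defs where

open import Data.Nat using (ℕ)
open import Data.Fin using (Fin) renaming (_≟_ to _≟ᶠ_)
open import Data.Fin.Subset using (Subset; ⊤) renaming (_∈_ to _∈ₛ_; _∉_ to _∉ₛ_)
open import Data.Fin.Subset.Properties using () renaming (_∈?_ to _∈ₛ?_)
open import Data.Product using (Σ; ∃; _×_; _,_; proj₁; proj₂; swap)
open import Data.Sum using (_⊎_)
open import Data.List using (List; []; _∷_; map; filter; foldr; allFin)
open import Data.List.Relation.Unary.All using (All)
open import Data.List.Relation.Unary.Unique.Propositional using (Unique)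
open import Data.List.Relation.Unary.AllPairs using (AllPairs)
open import Data.List.Membership.Propositional using () renaming (_∈_ to _∈ₗ_; _∉_ to _∉ₗ_)
open import Data.Rational using (ℚ; 0ℚ; 1ℚ; _+_; _-_; _*_; _≤_; _<_)
open import Relation.Binary.PropositionalEquality using (_≡_; _≢_)
open import Relation.Nullary using (¬_)
open import Function.Definitions using (Injective)

sumℚ : List ℚ → ℚ
sumℚ = foldr _+_ 0ℚ

SameEnds : ∀ {n} → Fin n × Fin n → Fin n × Fin n → Set
SameEnds p q = p ≡ q ⊎ p ≡ swap q

record Graph : Set where
  field
    n m        : ℕ
    ends       : Fin m → Fin n × Fin n
    loopless   : ∀ e → proj₁ (ends e) ≢ proj₂ (ends e)
    noParallel : ∀ e f → SameEnds (ends e) (ends f) → e ≡ f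

module GraphDefs (G : Graph) where
  open Graph G public
  open import Data.List.Membership.DecPropositional (_≟ᶠ_ {m}) using () renaming (_∈?_ to _∈ₗ?_)

  Vertex : Set
  Vertex = Fin n

  Edge : Set
  Edge = Fin m

  Joins : Edge → Vertex → Vertex → Set
  Joins e u v = ends e ≡ (u , v) ⊎ ends e ≡ (v , u)

  data Walk : Vertex → Vertex → Set where
    []   : ∀ {u} → Walk u u
    step : ∀ {u v w} (e : Edge) → Joins e u v → Walk v w → Walk u w

  edgesOf : ∀ {u w} → Walk u w → List Edge
  edgesOf []             = []
  edgesOf (step e _ W)   = e ∷ edgesOf W

  verticesOf : ∀ {u w} → Walk u w → List Vertex
  verticesOf {u} []           = u ∷ []
  verticesOf {u} (step _ _ W) = u ∷ verticesOf W

  IsPath : ∀ {u w} → Walk u w → Set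
  IsPath W = Unique (verticesOf W)

  InSub : Subset m → ∀ {u w} → Walk u w → Set
  InSub H W = All (_∈ₛ H) (edgesOf W)

  Weighting : Set
  Weighting = Edge → ℚ

  walkWeight : Weighting → ∀ {u w} → Walk u w → ℚ
  walkWeight wt W = sumℚ (map wt (edgesOf W))

  subWeight : Weighting → Subset m → ℚ
  subWeight wt H = sumℚ (map wt (filter (_∈ₛ? H) (allFin m)))

  IsDist : Weighting → Subset m → Vertex → Vertex → ℚ → Set
  IsDist wt H a b d =
    (Σ (Walk a b) λ W → InSub H W × walkWeight wt W ≡ d)
    × (∀ (W : Walk a b) → InSub H W → d ≤ walkWeight wt W)

  IsSpanner : Weighting → ℚ → Subset m → Set
  IsSpanner wt ε H = ∀ a b dG → IsDist wt ⊤ a b dG →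
    ∃ λ dH → IsDist wt H a b dH × dH ≤ (1ℚ + ε) * dG

  -- Spanning tree: connected and containing no simple cycle
  -- (a simple cycle = an edge e plus a simple path between its ends avoiding e)
  IsSpanningTree : Subset m → Set
  IsSpanningTree T =
    (∀ a b → Σ (Walk a b) λ W → InSub T W)
    × (¬ (Σ Edge λ e → e ∈ₛ T ×
          Σ (Walk (proj₁ (ends e)) (proj₂ (ends e))) λ P →
            InSub T P × IsPath P × e ∉ₗ edgesOf P))

  -- Charging schemes ------------------------------------------------------
  -- A detour (e , P) together with its (nonnegative) amount x_(e,P).
  -- A charging scheme is a finite list of such entries; detours not listed
  -- have x = 0.
  record Entry : Set where
    field
      edge   : Edge
      path   : Walk (proj₁ (ends edge)) (proj₂ (ends edge))
      isPath : IsPath path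
      avoids : edge ∉ₗ edgesOf path
      amount : ℚ
      nonneg : 0ℚ ≤ amount
  open Entry public

  Scheme : Set
  Scheme = List Entry

  Out : Scheme → Edge → ℚ
  Out S e = sumℚ (map amount (filter (λ en → edge en ≟ᶠ e) S))

  In : Scheme → Edge → ℚ
  In S e = sumℚ (map amount (filter (λ en → e ∈ₗ? edgesOf (path en)) S))

  Net : Scheme → Edge → ℚ
  Net S e = In S e - Out S e

  -- "en charges its path" iff its amount is positive
  record AcyclicChargingScheme (T : Subset m) (v : ℚ) (S : Scheme) : Set where
    field
      out≥1     : ∀ e → e ∉ₛ T → 1ℚ ≤ Out S e
      net≤0     : ∀ e → e ∉ₛ T → Net S e ≤ 0ℚ
      net≤v     : ∀ e → e ∈ₛ T → Net S e ≤ v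
      onlyNonT  : ∀ en → en ∈ₗ S → 0ℚ < amount en → edge en ∉ₛ T
      ordering  : Σ (Edge → ℕ) λ rank → Injective _≡_ _≡_ rank ×
                    (∀ en → en ∈ₗ S → 0ℚ < amount en →
                       ∀ e₂ → e₂ ∈ₗ edgesOf (path en) →
                       Data.Nat._<_ (rank (edge en)) (rank e₂))

  addSub : Subset m → Edge → Subset m
  addSub H e = H Data.Fin.Subset.∪ Data.Fin.Subset.⁅ e ⁆

  -- the test "(1+ε) w(e) < d_H(a,b)" for e = {a,b}
  -- (vacuously true if a, b are disconnected in H, i.e. d_H = ∞)
  AddCond : Weighting → ℚ → Subset m → Edge → Set
  AddCond wt ε H e = ∀ d → IsDist wt H (proj₁ (ends e)) (proj₂ (ends e)) d →
    (1ℚ + ε) * wt e < d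

  data Greedy (wt : Weighting) (ε : ℚ) : Subset m → List Edge → Subset m → Set where
    done : ∀ {H} → Greedy wt ε H [] H
    add  : ∀ {H e es H'} → AddCond wt ε H e →
           Greedy wt ε (addSub H e) es H' → Greedy wt ε H (e ∷ es) H'
    skip : ∀ {H e es H'} → ¬ AddCond wt ε H e →
           Greedy wt ε H es H' → Greedy wt ε H (e ∷ es) H'

  GreedyOrder : Weighting → Subset m → List Edge → Set
  GreedyOrder wt T es =
    Unique es × (∀ e → (e ∈ₗ es → e ∉ₛ T) × (e ∉ₛ T → e ∈ₗ es))
    × AllPairs (λ e f → wt e ≤ wt f) es

-- The greedy run keeps T, and an edge it skips already has a walk of weight at most (1+ε) w(e) in
-- the output G′, so replacing every edge of a shortest walk of G by such a walk shows that G′ is a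
-- (1+ε)-spanner. Processing edges by nondecreasing weight keeps every non-tree edge e of G′ far from
-- short detours: any other path of G′ between its ends weighs more than (1+ε) w(e). For the weight,
-- give each edge f the potential c(f) = w(f) if f ∈ G′, and otherwise the distance between its ends
-- in G′ through edges of rank at least that of f in the acyclic ordering. Along every charged detour
-- (e, P) the potential walks of the edges of P join the ends of e above its rank, so
-- c(P) ≥ c(e) + ε w(e) if e ∈ G′ − T and c(P) ≥ c(e) otherwise. Weighting the charging scheme by c
-- then gives ε w(G′ − T) ≤ v w(T).

module Submission where

open import Defs
open import Data.Fin.Subset using (Subset; _⊆_)
open import Data.Product using (_×_)
open import Data.List using (List)
open import Data.Rational using (ℚ; 0ℚ; 1ℚ; _+_; _*_; _÷_; _≤_; Positive)
open import Data.Rational.Properties using (pos⇒nonZero)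

open import Data.Nat as ℕ using (ℕ; zero; suc; z≤n; s≤s)
import Data.Nat.Properties as ℕ
open import Data.Fin using () renaming (_≟_ to _≟ᶠ_)
open import Data.Fin.Induction using (spo-wellFounded)
open import Data.Fin.Subset using (⁅_⁆) renaming (_∈_ to _∈ₛ_; _∉_ to _∉ₛ_)
import Data.Fin.Subset.Properties as Subset
open import Data.Fin.Subset.Properties using () renaming (_∈?_ to _∈ₛ?_)
open import Data.Product using (Σ; ∃; _,_; proj₁; proj₂)
open import Data.Product.Properties using (≡-dec)
open import Data.Sum using (_⊎_; inj₁; inj₂)
open import Data.List using ([]; _∷_; [_]; map; filter; _++_; length; allFin; concatMap; cartesianProduct)
import Data.List.Properties as List
open import Data.List.Relation.Unary.All as All using (All; []; _∷_)
import Data.List.Relation.Unary.All.Properties as All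
open import Data.List.Relation.Unary.Any as Any using (here; there)
open import Data.List.Relation.Unary.AllPairs using (AllPairs; []; _∷_)
open import Data.List.Relation.Unary.Unique.Propositional using (Unique)
open import Data.List.Relation.Unary.Unique.Propositional.Properties using (allFin⁺)
open import Data.List.Membership.Propositional using (_∈_; _∉_; lose)
open import Data.List.Membership.Propositional.Properties
  using (∈-++⁻; ∈-++⁺ˡ; ∈-++⁺ʳ; ∈-filter⁺; ∈-filter⁻; ∈-allFin; ∈-map⁺; ∈-concatMap⁺; ∈-cartesianProduct⁺)
import Data.List.Relation.Binary.Sublist.Propositional as Sublist
open import Data.List.Relation.Binary.Sublist.Propositional using ([]; _∷_; _∷ʳ_; ⊆-refl; ⊆-trans)
open import Data.List.Relation.Binary.Sublist.Propositional.Properties using (All-resp-⊆)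
open import Data.Rational using (_-_; -_; _<_; 1/_; nonNegative)
import Data.Rational.Properties as ℚ
open import Data.Rational.Solver using (module +-*-Solver)
open import Relation.Binary.Bundles using (DecTotalOrder)
open import Data.List.Extrema (DecTotalOrder.totalOrder ℚ.≤-decTotalOrder)
  using (argmin; argmin-all; f[argmin]≤f[xs])
open import Induction.WellFounded using (WellFounded; Acc; acc)
import Relation.Binary.Construct.On as On
import Relation.Binary.Construct.Flip.Ord as Flip
open import Relation.Binary.PropositionalEquality
  using (_≡_; _≢_; refl; sym; trans; cong; cong₂; subst; subst₂; module ≡-Reasoning)
open import Relation.Binary.Definitions using (DecidableEquality)
open import Relation.Nullary using (Dec; yes; no; ¬_; ¬?; _⊎-dec_; _×-dec_; contradiction)
open import Relation.Unary using (Decidable)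
open import Function using (id; _∘_; case_of_)
open +-*-Solver using (solve; _:+_; _:-_; _:*_; _:=_; con)

0≤⇒*-monoˡ-≤ : ∀ {r p q} → 0ℚ ≤ r → p ≤ q → r * p ≤ r * q
0≤⇒*-monoˡ-≤ {r} 0≤r = ℚ.*-monoˡ-≤-nonNeg r {{nonNegative 0≤r}}

0≤*0≤⇒0≤ : ∀ {p q} → 0ℚ ≤ p → 0ℚ ≤ q → 0ℚ ≤ p * q
0≤*0≤⇒0≤ {p} {q} 0≤p 0≤q = ℚ.≤-trans (ℚ.≤-reflexive (sym (ℚ.*-zeroʳ p))) (0≤⇒*-monoˡ-≤ 0≤p 0≤q)

≤⇒0≤- : ∀ {p q} → p ≤ q → 0ℚ ≤ q - p
≤⇒0≤- {p} h = ℚ.≤-trans (ℚ.≤-reflexive (sym (ℚ.+-inverseʳ p))) (ℚ.+-monoˡ-≤ _ h)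

∑[_]_ : ∀ {A : Set} → List A → (A → ℚ) → ℚ
∑[ xs ] f = sumℚ (map f xs)

module _ {A : Set} where

  ∑-++ : ∀ (f : A → ℚ) xs ys → ∑[ xs ++ ys ] f ≡ ∑[ xs ] f + ∑[ ys ] f
  ∑-++ f []       ys = sym (ℚ.+-identityˡ _)
  ∑-++ f (x ∷ xs) ys = trans (cong (f x +_) (∑-++ f xs ys)) (sym (ℚ.+-assoc (f x) _ _))

  ∑-cong : ∀ {f g : A → ℚ} xs → (∀ {x} → x ∈ xs → f x ≡ g x) → ∑[ xs ] f ≡ ∑[ xs ] g
  ∑-cong []       h = refl
  ∑-cong (x ∷ xs) h = cong₂ _+_ (h (here refl)) (∑-cong xs (λ x∈ → h (there x∈)))

  ∑-mono-≤ : ∀ {f g : A → ℚ} xs → (∀ {x} → x ∈ xs → f x ≤ g x) → ∑[ xs ] f ≤ ∑[ xs ] g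
  ∑-mono-≤ []       h = ℚ.≤-refl
  ∑-mono-≤ (x ∷ xs) h = ℚ.+-mono-≤ (h (here refl)) (∑-mono-≤ xs (λ x∈ → h (there x∈)))

  ∑-zero : ∀ {f : A → ℚ} xs → (∀ {x} → x ∈ xs → f x ≡ 0ℚ) → ∑[ xs ] f ≡ 0ℚ
  ∑-zero []       h = refl
  ∑-zero (x ∷ xs) h = trans (cong₂ _+_ (h (here refl)) (∑-zero xs (λ x∈ → h (there x∈)))) (ℚ.+-identityˡ 0ℚ)

  ∑-nonNeg : ∀ (f : A → ℚ) xs → (∀ x → 0ℚ ≤ f x) → 0ℚ ≤ ∑[ xs ] f
  ∑-nonNeg f xs h = ℚ.≤-trans (ℚ.≤-reflexive (sym (∑-zero {f = λ _ → 0ℚ} xs (λ _ → refl))))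
                              (∑-mono-≤ xs (λ {x} _ → h x))

  ∑-⊆-≤ : ∀ (f : A → ℚ) → (∀ x → 0ℚ ≤ f x) → ∀ {xs ys} → xs Sublist.⊆ ys → ∑[ xs ] f ≤ ∑[ ys ] f
  ∑-⊆-≤ f f≥0 []                 = ℚ.≤-refl
  ∑-⊆-≤ f f≥0 (y ∷ʳ τ)           = ℚ.≤-trans (ℚ.≤-reflexive (sym (ℚ.+-identityˡ _)))
                                             (ℚ.+-mono-≤ (f≥0 y) (∑-⊆-≤ f f≥0 τ))
  ∑-⊆-≤ f f≥0 {x ∷ _} (refl ∷ τ) = ℚ.+-monoʳ-≤ (f x) (∑-⊆-≤ f f≥0 τ)

  ∑-+ : ∀ (f g : A → ℚ) xs → ∑[ xs ] (λ x → f x + g x) ≡ ∑[ xs ] f + ∑[ xs ] g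
  ∑-+ f g []       = refl
  ∑-+ f g (x ∷ xs) rewrite ∑-+ f g xs =
    solve 4 (λ a b c d → (a :+ b) :+ (c :+ d) := (a :+ c) :+ (b :+ d)) refl (f x) (g x) (∑[ xs ] f) (∑[ xs ] g)

  ∑-minus : ∀ (f g : A → ℚ) xs → ∑[ xs ] (λ x → f x - g x) ≡ ∑[ xs ] f - ∑[ xs ] g
  ∑-minus f g []       = refl
  ∑-minus f g (x ∷ xs) rewrite ∑-minus f g xs =
    solve 4 (λ a b c d → (a :- b) :+ (c :- d) := (a :+ c) :- (b :+ d)) refl (f x) (g x) (∑[ xs ] f) (∑[ xs ] g)

  *-distribˡ-∑ : ∀ (k : ℚ) (f : A → ℚ) xs → k * ∑[ xs ] f ≡ ∑[ xs ] (λ x → k * f x)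
  *-distribˡ-∑ k f []       = ℚ.*-zeroʳ k
  *-distribˡ-∑ k f (x ∷ xs) = trans (ℚ.*-distribˡ-+ k (f x) _) (cong (k * f x +_) (*-distribˡ-∑ k f xs))

  ∑-pos⇒∃ : ∀ (f : A → ℚ) xs → 0ℚ < ∑[ xs ] f → ∃ λ x → x ∈ xs × 0ℚ < f x
  ∑-pos⇒∃ f []       0<0 = contradiction 0<0 (ℚ.<-irrefl refl)
  ∑-pos⇒∃ f (x ∷ xs) 0<s with 0ℚ ℚ.<? f x | 0ℚ ℚ.<? ∑[ xs ] f
  ... | yes 0<fx | _      = x , here refl , 0<fx
  ... | no _     | yes 0<r with ∑-pos⇒∃ f xs 0<r
  ...   | y , y∈ , 0<fy = y , there y∈ , 0<fy
  ∑-pos⇒∃ f (x ∷ xs) 0<s | no fx≤0 | no r≤0 = contradiction 0<0 (ℚ.<-irrefl refl)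
    where
    0<0 : 0ℚ < 0ℚ
    0<0 = ℚ.<-≤-trans 0<s (ℚ.+-mono-≤ (ℚ.≮⇒≥ fx≤0) (ℚ.≮⇒≥ r≤0))

∑-swap : ∀ {A B : Set} (F : A → B → ℚ) xs ys →
  ∑[ xs ] (λ x → ∑[ ys ] (F x)) ≡ ∑[ ys ] (λ y → ∑[ xs ] (λ x → F x y))
∑-swap F []       ys = sym (∑-zero ys (λ _ → refl))
∑-swap F (x ∷ xs) ys = trans (cong (∑[ ys ] (F x) +_) (∑-swap F xs ys))
                             (sym (∑-+ (F x) (λ y → ∑[ xs ] (λ x′ → F x′ y)) ys))

_when_ : ∀ {P : Set} → ℚ → Dec P → ℚ
q when yes _ = q
q when no _  = 0ℚ

module _ {P : Set} where

  when-yes : ∀ (d : Dec P) {q} → P → q when d ≡ q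
  when-yes (yes _) p = refl
  when-yes (no ¬p) p = contradiction p ¬p

  when-no : ∀ (d : Dec P) {q} → ¬ P → q when d ≡ 0ℚ
  when-no (yes p) ¬p = contradiction p ¬p
  when-no (no _)  ¬p = refl

  *-when : ∀ (d : Dec P) k q → k * (q when d) ≡ (k * q) when d
  *-when (yes _) k q = refl
  *-when (no _)  k q = ℚ.*-zeroʳ k

  when-nonNeg : ∀ (d : Dec P) {q} → 0ℚ ≤ q → 0ℚ ≤ q when d
  when-nonNeg (yes _) 0≤q = 0≤q
  when-nonNeg (no _)  0≤q = ℚ.≤-refl

module _ {A : Set} where

  ∑-filter : ∀ {P : A → Set} (P? : Decidable P) (g : A → ℚ) xs →
    sumℚ (map g (filter P? xs)) ≡ ∑[ xs ] (λ x → g x when P? x)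
  ∑-filter P? g []       = refl
  ∑-filter P? g (x ∷ xs) with P? x
  ... | yes _ = cong (g x +_) (∑-filter P? g xs)
  ... | no _  = trans (∑-filter P? g xs) (sym (ℚ.+-identityˡ _))

  module _ (_≟_ : DecidableEquality A) where
    open import Data.List.Membership.DecPropositional _≟_ using (_∈?_)

    ∑-when-≡ : ∀ (g : A → ℚ) {y} xs → Unique xs → y ∈ xs → ∑[ xs ] (λ x → g x when (y ≟ x)) ≡ g y
    ∑-when-≡ g (x ∷ xs) (x∉xs ∷ _) (here refl) =
      trans (cong₂ _+_ (when-yes (x ≟ x) refl)
                       (∑-zero xs (λ x′∈ → when-no (x ≟ _) (λ { refl → All.lookup x∉xs x′∈ refl }))))
            (ℚ.+-identityʳ (g x))
    ∑-when-≡ g (x ∷ xs) (x∉xs ∷ u) (there y∈) =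
      trans (cong₂ _+_ (when-no (_ ≟ x) (λ { refl → All.lookup x∉xs y∈ refl })) (∑-when-≡ g xs u y∈))
            (ℚ.+-identityˡ _)

    ∑-when-∈ : ∀ (g : A → ℚ) {us} → Unique us → (∀ x → x ∈ us) →
      ∀ ys → Unique ys → ∑[ us ] (λ x → g x when (x ∈? ys)) ≡ ∑[ ys ] g
    ∑-when-∈ g {us} uniq complete []       _            = ∑-zero us (λ _ → refl)
    ∑-when-∈ g {us} uniq complete (y ∷ ys) (y∉ys ∷ u) = begin
        ∑[ us ] (λ x → g x when (x ∈? (y ∷ ys)))
      ≡⟨ ∑-cong us (λ {x} _ → split x (x ∈? (y ∷ ys)) (y ≟ x) (x ∈? ys)) ⟩
        ∑[ us ] (λ x → g x when (y ≟ x) + g x when (x ∈? ys))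
      ≡⟨ ∑-+ _ _ us ⟩
        ∑[ us ] (λ x → g x when (y ≟ x)) + ∑[ us ] (λ x → g x when (x ∈? ys))
      ≡⟨ cong₂ _+_ (∑-when-≡ g us uniq (complete y)) (∑-when-∈ g uniq complete ys u) ⟩
        g y + ∑[ ys ] g ∎
      where
      open ≡-Reasoning
      split : ∀ x (d : Dec (x ∈ y ∷ ys)) (d₁ : Dec (y ≡ x)) (d₂ : Dec (x ∈ ys)) →
        g x when d ≡ g x when d₁ + g x when d₂
      split x _                  (yes refl) (yes y∈ys) = contradiction refl (All.lookup y∉ys y∈ys)
      split x (yes _)            (yes refl) (no _)     = sym (ℚ.+-identityʳ _)
      split x (yes _)            (no _)     (yes _)    = sym (ℚ.+-identityˡ _)
      split x (yes (here refl))  (no y≢x)   (no _)     = contradiction refl y≢x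
      split x (yes (there x∈ys)) (no _)     (no x∉ys)  = contradiction x∈ys x∉ys
      split x (no x∉)            (yes refl) _          = contradiction (here refl) x∉
      split x (no x∉)            (no _)     (yes x∈ys) = contradiction (there x∈ys) x∉
      split x (no _)             (no _)     (no _)     = sym (ℚ.+-identityˡ 0ℚ)

∑-*-∑-when : ∀ {A B : Set} {D : A → B → Set} (D? : ∀ x y → Dec (D x y)) (g : A → ℚ) (a : B → ℚ) xs ys →
  ∑[ xs ] (λ x → g x * ∑[ ys ] (λ y → a y when D? x y)) ≡ ∑[ ys ] (λ y → a y * ∑[ xs ] (λ x → g x when D? x y))
∑-*-∑-when D? g a xs ys = begin
  ∑[ xs ] (λ x → g x * ∑[ ys ] (λ y → a y when D? x y))
    ≡⟨ ∑-cong xs (λ {x} _ → trans (*-distribˡ-∑ (g x) _ ys)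
                                  (∑-cong ys (λ {y} _ → *-when (D? x y) (g x) (a y)))) ⟩
  ∑[ xs ] (λ x → ∑[ ys ] (λ y → (g x * a y) when D? x y))
    ≡⟨ ∑-swap (λ x y → (g x * a y) when D? x y) xs ys ⟩
  ∑[ ys ] (λ y → ∑[ xs ] (λ x → (g x * a y) when D? x y))
    ≡⟨ ∑-cong ys (λ {y} _ → trans (∑-cong xs (λ {x} _ → trans (cong (_when D? x y) (ℚ.*-comm (g x) (a y)))
                                                                (sym (*-when (D? x y) (a y) (g x)))))
                                  (sym (*-distribˡ-∑ (a y) _ xs))) ⟩
  ∑[ ys ] (λ y → a y * ∑[ xs ] (λ x → g x when D? x y)) ∎
  where open ≡-Reasoning

Unique-⊆⇒length≤ : ∀ {A : Set} → DecidableEquality A → ∀ {xs ys : List A} → Unique xs →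
  (∀ {x} → x ∈ xs → x ∈ ys) → length xs ℕ.≤ length ys
Unique-⊆⇒length≤ _≟_ {[]}     _           _  = z≤n
Unique-⊆⇒length≤ _≟_ {x ∷ xs} {ys} (x∉xs ∷ u) xs⊆ys =
  ℕ.<-≤-trans (s≤s (Unique-⊆⇒length≤ _≟_ u xs⊆ys-x))
              (List.filter-notAll (¬? ∘ (x ≟_)) ys (Any.map (λ x≡y x≢y → x≢y x≡y) (xs⊆ys (here refl))))
  where
  xs⊆ys-x : ∀ {z} → z ∈ xs → z ∈ filter (¬? ∘ (x ≟_)) ys
  xs⊆ys-x z∈xs = ∈-filter⁺ (¬? ∘ (x ≟_)) (xs⊆ys (there z∈xs)) (All.lookup x∉xs z∈xs)

module Walks (G : Graph) where
  open GraphDefs G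
  open import Data.List.Membership.DecPropositional (_≟ᶠ_ {n}) using () renaming (_∈?_ to _∈ᵥ?_)

  EndWalk : Edge → Set
  EndWalk e = Walk (proj₁ (ends e)) (proj₂ (ends e))

  edgeWalk : ∀ e → EndWalk e
  edgeWalk e = step e (inj₁ refl) []

  infixr 5 _▸_
  _▸_ : ∀ {a b c} → Walk a b → Walk b c → Walk a c
  []         ▸ V = V
  step e j W ▸ V = step e j (W ▸ V)

  edgesOf-▸ : ∀ {a b c} (W : Walk a b) (V : Walk b c) → edgesOf (W ▸ V) ≡ edgesOf W ++ edgesOf V
  edgesOf-▸ []           V = refl
  edgesOf-▸ (step e j W) V = cong (e ∷_) (edgesOf-▸ W V)

  ∈-▸⁻ : ∀ {a b c} (W : Walk a b) (V : Walk b c) {x} → x ∈ edgesOf (W ▸ V) → x ∈ edgesOf W ⊎ x ∈ edgesOf V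
  ∈-▸⁻ W V x∈ = ∈-++⁻ (edgesOf W) (subst (_ ∈_) (edgesOf-▸ W V) x∈)

  All-▸ : ∀ {P : Edge → Set} {a b c} (W : Walk a b) (V : Walk b c) →
    All P (edgesOf W) → All P (edgesOf V) → All P (edgesOf (W ▸ V))
  All-▸ W V pW pV = subst (All _) (sym (edgesOf-▸ W V)) (All.++⁺ pW pV)

  rev : ∀ {a b} → Walk a b → Walk b a
  rev []                  = []
  rev (step e (inj₁ p) W) = rev W ▸ step e (inj₂ p) []
  rev (step e (inj₂ p) W) = rev W ▸ step e (inj₁ p) []

  ∈-rev⁻ : ∀ {a b} (W : Walk a b) {x} → x ∈ edgesOf (rev W) → x ∈ edgesOf W
  ∈-rev⁻ []                  ()
  ∈-rev⁻ (step e (inj₁ p) W) x∈ with ∈-▸⁻ (rev W) _ x∈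
  ... | inj₁ x∈W       = there (∈-rev⁻ W x∈W)
  ... | inj₂ (here x≡e) = here x≡e
  ∈-rev⁻ (step e (inj₂ p) W) x∈ with ∈-▸⁻ (rev W) _ x∈
  ... | inj₁ x∈W       = there (∈-rev⁻ W x∈W)
  ... | inj₂ (here x≡e) = here x≡e

  All-rev : ∀ {Q : Edge → Set} {a b} (W : Walk a b) → All Q (edgesOf W) → All Q (edgesOf (rev W))
  All-rev W qW = All.tabulate (λ x∈ → All.lookup qW (∈-rev⁻ W x∈))

  retrace : ∀ {p q} → SameEnds p q → Walk (proj₁ q) (proj₂ q) → Walk (proj₁ p) (proj₂ p)
  retrace (inj₁ refl) W = W
  retrace (inj₂ refl) W = rev W

  ∈-retrace⁻ : ∀ {p q} (s : SameEnds p q) (W : Walk (proj₁ q) (proj₂ q)) {x} →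
    x ∈ edgesOf (retrace s W) → x ∈ edgesOf W
  ∈-retrace⁻ (inj₁ refl) W x∈ = x∈
  ∈-retrace⁻ (inj₂ refl) W x∈ = ∈-rev⁻ W x∈

  All-retrace : ∀ {Q : Edge → Set} {p q} (s : SameEnds p q) (W : Walk (proj₁ q) (proj₂ q)) →
    All Q (edgesOf W) → All Q (edgesOf (retrace s W))
  All-retrace s W qW = All.tabulate (λ x∈ → All.lookup qW (∈-retrace⁻ s W x∈))

  SameEnds-sym : ∀ {p q : Vertex × Vertex} → SameEnds p q → SameEnds q p
  SameEnds-sym (inj₁ refl) = inj₁ refl
  SameEnds-sym (inj₂ refl) = inj₂ refl

  head-∈-verticesOf : ∀ {a b} (W : Walk a b) → a ∈ verticesOf W
  head-∈-verticesOf []           = here refl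
  head-∈-verticesOf (step _ _ _) = here refl

  ends-∈-verticesOf : ∀ {a b} (W : Walk a b) {e} → e ∈ edgesOf W →
    proj₁ (ends e) ∈ verticesOf W × proj₂ (ends e) ∈ verticesOf W
  ends-∈-verticesOf (step e (inj₁ p) W) (here refl) rewrite p = here refl , there (head-∈-verticesOf W)
  ends-∈-verticesOf (step e (inj₂ p) W) (here refl) rewrite p = there (head-∈-verticesOf W) , here refl
  ends-∈-verticesOf (step e j W) (there e∈W) =
    let (∈₁ , ∈₂) = ends-∈-verticesOf W e∈W in there ∈₁ , there ∈₂

  IsPath⇒Unique-edges : ∀ {a b} (W : Walk a b) → IsPath W → Unique (edgesOf W)
  IsPath⇒Unique-edges []           _            = []
  IsPath⇒Unique-edges (step e j W) (a∉W ∷ isP) =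
    All.tabulate (λ x∈W e≡x → e∉W j a∉W (subst (_∈ edgesOf W) (sym e≡x) x∈W)) ∷ IsPath⇒Unique-edges W isP
    where
    e∉W : ∀ {a v} → Joins e a v → All (a ≢_) (verticesOf W) → e ∉ edgesOf W
    e∉W (inj₁ p) a∉ e∈W =
      All.lookup a∉ (subst (_∈ verticesOf W) (cong proj₁ p) (proj₁ (ends-∈-verticesOf W e∈W))) refl
    e∉W (inj₂ p) a∉ e∈W =
      All.lookup a∉ (subst (_∈ verticesOf W) (cong proj₂ p) (proj₂ (ends-∈-verticesOf W e∈W))) refl

  length-verticesOf : ∀ {a b} (W : Walk a b) → length (verticesOf W) ≡ suc (length (edgesOf W))
  length-verticesOf []           = refl
  length-verticesOf (step _ _ W) = cong suc (length-verticesOf W)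

  IsPath⇒length<n : ∀ {a b} (W : Walk a b) → IsPath W → length (edgesOf W) ℕ.< n
  IsPath⇒length<n W isP = subst₂ ℕ._≤_ (length-verticesOf W) (List.length-tabulate id)
    (Unique-⊆⇒length≤ _≟ᶠ_ isP (λ {x} _ → ∈-allFin x))

  suffixFrom : ∀ {v w u} (W : Walk v w) → u ∈ verticesOf W → Walk u w
  suffixFrom []           (here refl) = []
  suffixFrom (step e j W) (here refl) = step e j W
  suffixFrom (step _ _ W) (there u∈)  = suffixFrom W u∈

  suffixFrom-isPath : ∀ {v w u} (W : Walk v w) (u∈ : u ∈ verticesOf W) → IsPath W → IsPath (suffixFrom W u∈)
  suffixFrom-isPath []           (here refl) isP        = isP
  suffixFrom-isPath (step _ _ _) (here refl) isP        = isP
  suffixFrom-isPath (step _ _ W) (there u∈)  (_ ∷ isP) = suffixFrom-isPath W u∈ isP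

  suffixFrom-⊆ : ∀ {v w u} (W : Walk v w) (u∈ : u ∈ verticesOf W) →
    edgesOf (suffixFrom W u∈) Sublist.⊆ edgesOf W
  suffixFrom-⊆ []           (here refl) = ⊆-refl
  suffixFrom-⊆ (step _ _ _) (here refl) = ⊆-refl
  suffixFrom-⊆ (step e _ W) (there u∈)  = e ∷ʳ suffixFrom-⊆ W u∈

  eraseLoops : ∀ {u w} (W : Walk u w) → Σ (Walk u w) λ P → IsPath P × edgesOf P Sublist.⊆ edgesOf W
  eraseLoops []               = [] , [] ∷ [] , ⊆-refl
  eraseLoops {u} (step e j W) with eraseLoops W
  ... | P , isP , P⊆W with u ∈ᵥ? verticesOf P
  ...   | yes u∈P = suffixFrom P u∈P , suffixFrom-isPath P u∈P isP , e ∷ʳ ⊆-trans (suffixFrom-⊆ P u∈P) P⊆W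
  ...   | no  u∉P = step e j P , All.¬Any⇒All¬ _ u∉P ∷ isP , refl Sublist.∷ P⊆W

  joins? : ∀ e u v → Dec (Joins e u v)
  joins? e u v = ends e ≟ₚ (u , v) ⊎-dec ends e ≟ₚ (v , u)
    where _≟ₚ_ = ≡-dec _≟ᶠ_ _≟ᶠ_

  trivialWalks : ∀ {a b} → Dec (a ≡ b) → List (Walk a b)
  trivialWalks (yes refl) = [ [] ]
  trivialWalks (no _)     = []

  []∈trivialWalks : ∀ {a} {d : Dec (a ≡ a)} → [] ∈ trivialWalks d
  []∈trivialWalks {d = yes refl} = here refl
  []∈trivialWalks {d = no a≢a}   = contradiction refl a≢a

  extendBy : ∀ {a v b} e → Dec (Joins e a v) → List (Walk v b) → List (Walk a b)
  extendBy e (yes j) Ws = map (step e j) Ws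
  extendBy e (no _)  Ws = []

  ∈-extendBy : ∀ {a v b e} (d : Dec (Joins e a v)) → Joins e a v → ∀ {W} {Ws : List (Walk v b)} →
    W ∈ Ws → ∃ λ j → step e j W ∈ extendBy e d Ws
  ∈-extendBy (yes j) _ W∈ = j , ∈-map⁺ (step _ j) W∈
  ∈-extendBy (no ¬j) j _  = contradiction j ¬j

  -- Contains every walk with at most k edges, up to the proofs of its Joins steps.
  walksUpTo : ℕ → ∀ a b → List (Walk a b)
  walksUpTo zero    a b = trivialWalks (a ≟ᶠ b)
  walksUpTo (suc k) a b = trivialWalks (a ≟ᶠ b) ++
    concatMap (λ (e , v) → extendBy e (joins? e a v) (walksUpTo k v b)) (cartesianProduct (allFin m) (allFin n))

  walksUpTo-complete : ∀ k {a b} (W : Walk a b) → length (edgesOf W) ℕ.≤ k →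
    ∃ λ W′ → W′ ∈ walksUpTo k a b × edgesOf W′ ≡ edgesOf W
  walksUpTo-complete zero    [] _ = [] , []∈trivialWalks , refl
  walksUpTo-complete (suc k) {a} [] _ = [] , ∈-++⁺ˡ ([]∈trivialWalks {d = a ≟ᶠ a}) , refl
  walksUpTo-complete (suc k) {a} {b} (step {v = v} e j W) (s≤s |W|≤k) with walksUpTo-complete k W |W|≤k
  ... | W′ , W′∈ , edges≡ with ∈-extendBy (joins? e a v) j W′∈
  ...   | j′ , stepW′∈ =
    step e j′ W′ ,
    ∈-++⁺ʳ (trivialWalks (a ≟ᶠ b))
      (∈-concatMap⁺ _ (lose (∈-cartesianProduct⁺ (∈-allFin e) (∈-allFin v)) stepW′∈)) ,
    cong (e ∷_) edges≡

  substitute : ∀ {a b} (W : Walk a b) → (∀ {h} → h ∈ edgesOf W → EndWalk h) → Walk a b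
  substitute []           V = []
  substitute (step h j W) V = retrace (SameEnds-sym j) (V (here refl)) ▸ substitute W (λ h∈ → V (there h∈))

  All-substitute : ∀ {Q : Edge → Set} {a b} (W : Walk a b) (V : ∀ {h} → h ∈ edgesOf W → EndWalk h) →
    (∀ {h} (h∈ : h ∈ edgesOf W) → All Q (edgesOf (V h∈))) → All Q (edgesOf (substitute W V))
  All-substitute []           V qV = []
  All-substitute (step h j W) V qV =
    All-▸ (retrace (SameEnds-sym j) (V (here refl))) _
      (All-retrace (SameEnds-sym j) _ (qV (here refl)))
      (All-substitute W (λ h∈ → V (there h∈)) (λ h∈ → qV (there h∈)))

module WeightedWalks (G : Graph) (wt : GraphDefs.Weighting G) (wt≥0 : ∀ e → 0ℚ ≤ wt e) where
  open GraphDefs G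
  open Walks G

  weight : ∀ {a b} → Walk a b → ℚ
  weight = walkWeight wt

  weight-nonNeg : ∀ {a b} (W : Walk a b) → 0ℚ ≤ weight W
  weight-nonNeg W = ∑-nonNeg wt (edgesOf W) wt≥0

  weight-⊆ : ∀ {a b c d} (V : Walk a b) (W : Walk c d) → edgesOf V Sublist.⊆ edgesOf W → weight V ≤ weight W
  weight-⊆ V W = ∑-⊆-≤ wt wt≥0

  weight-edgeWalk : ∀ e → weight (edgeWalk e) ≡ wt e
  weight-edgeWalk e = ℚ.+-identityʳ (wt e)

  weight-▸ : ∀ {a b c} (W : Walk a b) (V : Walk b c) → weight (W ▸ V) ≡ weight W + weight V
  weight-▸ W V = trans (cong (∑[_] wt) (edgesOf-▸ W V)) (∑-++ wt (edgesOf W) (edgesOf V))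

  weight-▸edge : ∀ {a b c e} (V : Walk a b) (j : Joins e b c) → weight (V ▸ step e j []) ≡ wt e + weight V
  weight-▸edge {e = e} V j = trans (weight-▸ V (step e j []))
    (trans (cong (weight V +_) (ℚ.+-identityʳ (wt e))) (ℚ.+-comm (weight V) (wt e)))

  weight-rev : ∀ {a b} (W : Walk a b) → weight (rev W) ≡ weight W
  weight-rev []                  = refl
  weight-rev (step e (inj₁ p) W) = trans (weight-▸edge (rev W) (inj₂ p)) (cong (wt e +_) (weight-rev W))
  weight-rev (step e (inj₂ p) W) = trans (weight-▸edge (rev W) (inj₁ p)) (cong (wt e +_) (weight-rev W))

  weight-retrace : ∀ {p q} (s : SameEnds p q) (W : Walk (proj₁ q) (proj₂ q)) → weight (retrace s W) ≡ weight W
  weight-retrace (inj₁ refl) W = refl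
  weight-retrace (inj₂ refl) W = weight-rev W

  weight-substitute-≤ : ∀ (c : Edge → ℚ) {a b} (W : Walk a b) (V : ∀ {h} → h ∈ edgesOf W → EndWalk h) →
    (∀ {h} (h∈ : h ∈ edgesOf W) → weight (V h∈) ≤ c h) → weight (substitute W V) ≤ ∑[ edgesOf W ] c
  weight-substitute-≤ c []           V V≤c = ℚ.≤-refl
  weight-substitute-≤ c (step h j W) V V≤c = begin
    weight (retrace (SameEnds-sym j) (V (here refl)) ▸ substitute W (V ∘ there))
      ≡⟨ weight-▸ (retrace (SameEnds-sym j) (V (here refl))) _ ⟩
    weight (retrace (SameEnds-sym j) (V (here refl))) + weight (substitute W (V ∘ there))
      ≡⟨ cong (_+ _) (weight-retrace (SameEnds-sym j) (V (here refl))) ⟩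
    weight (V (here refl)) + weight (substitute W (V ∘ there))
      ≤⟨ ℚ.+-mono-≤ (V≤c (here refl)) (weight-substitute-≤ c W (V ∘ there) (V≤c ∘ there)) ⟩
    c h + ∑[ edgesOf W ] c ∎
    where open ℚ.≤-Reasoning

  IsDistWithin : (Edge → Set) → Vertex → Vertex → ℚ → Set
  IsDistWithin P a b d = (Σ (Walk a b) λ W → All P (edgesOf W) × weight W ≡ d)
                       × (∀ (W : Walk a b) → All P (edgesOf W) → d ≤ weight W)

  IsDistWithin-unique : ∀ {P a b d d′} → IsDistWithin P a b d → IsDistWithin P a b d′ → d ≡ d′
  IsDistWithin-unique ((W , pW , refl) , d≤) ((W′ , pW′ , refl) , d′≤) = ℚ.≤-antisym (d≤ W′ pW′) (d′≤ W pW)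

  module _ {P : Edge → Set} (P? : Decidable P) where

    candidates : ∀ a b → List (Walk a b)
    candidates a b = filter (All.all? P? ∘ edgesOf) (walksUpTo n a b)

    candidate-within : ∀ {a b} {W : Walk a b} → W ∈ candidates a b → All P (edgesOf W)
    candidate-within {a} {b} W∈ = proj₂ (∈-filter⁻ (All.all? P? ∘ edgesOf) {xs = walksUpTo n a b} W∈)

    candidate-≤ : ∀ {a b} (W : Walk a b) → All P (edgesOf W) →
      ∃ λ W′ → W′ ∈ candidates a b × weight W′ ≤ weight W
    candidate-≤ W pW with eraseLoops W
    ... | Q , isPath-Q , Q⊆W with walksUpTo-complete n Q (ℕ.<⇒≤ (IsPath⇒length<n Q isPath-Q))
    ...   | W′ , W′∈ , edges≡ =
      W′ , ∈-filter⁺ (All.all? P? ∘ edgesOf) W′∈ (subst (All P) (sym edges≡) (All-resp-⊆ Q⊆W pW)) ,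
      ℚ.≤-trans (ℚ.≤-reflexive (cong (∑[_] wt) edges≡)) (weight-⊆ Q W Q⊆W)

    distance : ∀ {a b} (W : Walk a b) → All P (edgesOf W) → Σ ℚ (IsDistWithin P a b)
    distance {a} {b} W pW = weight shortest , (shortest , within , refl) , shortest-≤
      where
      start = proj₁ (candidate-≤ W pW)
      shortest = argmin weight start (candidates a b)
      within : All P (edgesOf shortest)
      within = argmin-all weight (candidate-within (proj₁ (proj₂ (candidate-≤ W pW))))
                                 (All.tabulate candidate-within)
      shortest-≤ : ∀ V → All P (edgesOf V) → weight shortest ≤ weight V
      shortest-≤ V pV with candidate-≤ V pV
      ... | V′ , V′∈ , V′≤V = ℚ.≤-trans (All.lookup (f[argmin]≤f[xs] start (candidates a b)) V′∈) V′≤V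

module Charging (G : Graph) where
  open GraphDefs G
  open Walks G
  open import Data.List.Membership.DecPropositional (_≟ᶠ_ {m}) using () renaming (_∈?_ to _∈ₑ?_)

  pathCost : (Edge → ℚ) → Entry → ℚ
  pathCost c en = ∑[ edgesOf (path en) ] c

  ∑-*-Out : ∀ S (g : Edge → ℚ) → ∑[ allFin m ] (λ f → g f * Out S f) ≡ ∑[ S ] (λ en → amount en * g (edge en))
  ∑-*-Out S g = begin
    ∑[ allFin m ] (λ f → g f * Out S f)
      ≡⟨ ∑-cong (allFin m) (λ {f} _ → cong (g f *_) (∑-filter (λ en → edge en ≟ᶠ f) amount S)) ⟩
    ∑[ allFin m ] (λ f → g f * ∑[ S ] (λ en → amount en when (edge en ≟ᶠ f)))
      ≡⟨ ∑-*-∑-when (λ f en → edge en ≟ᶠ f) g amount (allFin m) S ⟩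
    ∑[ S ] (λ en → amount en * ∑[ allFin m ] (λ f → g f when (edge en ≟ᶠ f)))
      ≡⟨ ∑-cong S (λ {en} _ → cong (amount en *_)
           (∑-when-≡ _≟ᶠ_ g (allFin m) (allFin⁺ m) (∈-allFin (edge en)))) ⟩
    ∑[ S ] (λ en → amount en * g (edge en)) ∎
    where open ≡-Reasoning

  ∑-*-In : ∀ S (c : Edge → ℚ) → ∑[ allFin m ] (λ f → c f * In S f) ≡ ∑[ S ] (λ en → amount en * pathCost c en)
  ∑-*-In S c = begin
    ∑[ allFin m ] (λ f → c f * In S f)
      ≡⟨ ∑-cong (allFin m) (λ {f} _ → cong (c f *_) (∑-filter (λ en → f ∈ₑ? edgesOf (path en)) amount S)) ⟩
    ∑[ allFin m ] (λ f → c f * ∑[ S ] (λ en → amount en when (f ∈ₑ? edgesOf (path en))))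
      ≡⟨ ∑-*-∑-when (λ f en → f ∈ₑ? edgesOf (path en)) c amount (allFin m) S ⟩
    ∑[ S ] (λ en → amount en * ∑[ allFin m ] (λ f → c f when (f ∈ₑ? edgesOf (path en))))
      ≡⟨ ∑-cong S (λ {en} _ → cong (amount en *_)
           (∑-when-∈ _≟ᶠ_ c (allFin⁺ m) ∈-allFin (edgesOf (path en))
                     (IsPath⇒Unique-edges (path en) (isPath en)))) ⟩
    ∑[ S ] (λ en → amount en * pathCost c en) ∎
    where open ≡-Reasoning

  ∑-*-Net : ∀ S (c : Edge → ℚ) →
    ∑[ allFin m ] (λ f → c f * Net S f) ≡ ∑[ S ] (λ en → amount en * (pathCost c en - c (edge en)))
  ∑-*-Net S c = begin
    ∑[ allFin m ] (λ f → c f * Net S f)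
      ≡⟨ ∑-cong (allFin m) (λ {f} _ → *-distribˡ-minus (c f) (In S f) (Out S f)) ⟩
    ∑[ allFin m ] (λ f → c f * In S f - c f * Out S f)
      ≡⟨ ∑-minus _ _ (allFin m) ⟩
    ∑[ allFin m ] (λ f → c f * In S f) - ∑[ allFin m ] (λ f → c f * Out S f)
      ≡⟨ cong₂ _-_ (∑-*-In S c) (∑-*-Out S c) ⟩
    ∑[ S ] (λ en → amount en * pathCost c en) - ∑[ S ] (λ en → amount en * c (edge en))
      ≡⟨ sym (∑-minus _ _ S) ⟩
    ∑[ S ] (λ en → amount en * pathCost c en - amount en * c (edge en))
      ≡⟨ ∑-cong S (λ {en} _ → sym (*-distribˡ-minus (amount en) (pathCost c en) (c (edge en)))) ⟩
    ∑[ S ] (λ en → amount en * (pathCost c en - c (edge en))) ∎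
    where
    open ≡-Reasoning
    *-distribˡ-minus : ∀ a p q → a * (p - q) ≡ a * p - a * q
    *-distribˡ-minus = solve 3 (λ a p q → a :* (p :- q) := a :* p :- a :* q) refl

  -- Double counting gives Σ_f c(f) Net(f) = Σ_(e,P) x(e,P) (c(P) − c(e)); this is at least Σ g
  -- because Out ≥ 1 off T, and at most v · c(T) by the conditions on Net.
  charging-bound : ∀ {T v S} → AcyclicChargingScheme T v S → (c g : Edge → ℚ) →
    (∀ f → 0ℚ ≤ c f) → (∀ f → 0ℚ ≤ g f) → (∀ f → f ∈ₛ T → g f ≡ 0ℚ) →
    (∀ en → en ∈ S → 0ℚ < amount en → g (edge en) ≤ pathCost c en - c (edge en)) →
    ∑[ allFin m ] g ≤ v * ∑[ allFin m ] (λ f → c f when (f ∈ₛ? T))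
  charging-bound {T} {v} {S} scheme c g c≥0 g≥0 g≡0 g≤cost = begin
    ∑[ allFin m ] g                                            ≤⟨ ∑-mono-≤ (allFin m) (λ {f} _ → g≤g*Out f) ⟩
    ∑[ allFin m ] (λ f → g f * Out S f)                        ≡⟨ ∑-*-Out S g ⟩
    ∑[ S ] (λ en → amount en * g (edge en))                    ≤⟨ ∑-mono-≤ S (λ {en} en∈S → entry-≤ en en∈S) ⟩
    ∑[ S ] (λ en → amount en * (pathCost c en - c (edge en)))  ≡⟨ sym (∑-*-Net S c) ⟩
    ∑[ allFin m ] (λ f → c f * Net S f)                        ≤⟨ ∑-mono-≤ (allFin m) (λ {f} _ → c*Net≤ f) ⟩
    ∑[ allFin m ] (λ f → v * (c f when (f ∈ₛ? T)))             ≡⟨ sym (*-distribˡ-∑ v _ (allFin m)) ⟩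
    v * ∑[ allFin m ] (λ f → c f when (f ∈ₛ? T)) ∎
    where
    open ℚ.≤-Reasoning
    open AcyclicChargingScheme scheme
    g≤g*Out : ∀ f → g f ≤ g f * Out S f
    g≤g*Out f with f ∈ₛ? T
    ... | yes f∈T = ℚ.≤-reflexive (trans (g≡0 f f∈T)
                                          (sym (trans (cong (_* Out S f) (g≡0 f f∈T)) (ℚ.*-zeroˡ (Out S f)))))
    ... | no  f∉T = ℚ.≤-trans (ℚ.≤-reflexive (sym (ℚ.*-identityʳ (g f)))) (0≤⇒*-monoˡ-≤ (g≥0 f) (out≥1 f f∉T))
    entry-≤ : ∀ en → en ∈ S → amount en * g (edge en) ≤ amount en * (pathCost c en - c (edge en))
    entry-≤ en en∈S with 0ℚ ℚ.<? amount en
    ... | yes 0<a = 0≤⇒*-monoˡ-≤ (nonneg en) (g≤cost en en∈S 0<a)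
    ... | no  0≮a rewrite ℚ.≤-antisym (ℚ.≮⇒≥ 0≮a) (nonneg en) =
      ℚ.≤-reflexive (trans (ℚ.*-zeroˡ (g (edge en))) (sym (ℚ.*-zeroˡ (pathCost c en - c (edge en)))))
    c*Net≤ : ∀ f → c f * Net S f ≤ v * (c f when (f ∈ₛ? T))
    c*Net≤ f with f ∈ₛ? T
    ... | yes f∈T = ℚ.≤-trans (0≤⇒*-monoˡ-≤ (c≥0 f) (net≤v f f∈T)) (ℚ.≤-reflexive (ℚ.*-comm (c f) v))
    ... | no  f∉T = ℚ.≤-trans (0≤⇒*-monoˡ-≤ (c≥0 f) (net≤0 f f∉T))
                              (ℚ.≤-reflexive (trans (ℚ.*-zeroʳ (c f)) (sym (ℚ.*-zeroʳ v))))

module GreedyRun (G : Graph) (wt : GraphDefs.Weighting G) (wt≥0 : ∀ e → 0ℚ ≤ wt e)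
                 (ε : ℚ) (ε≥0 : 0ℚ ≤ ε) (T : Subset (Graph.m G))
                 (T-connected : ∀ a b → Σ (GraphDefs.Walk G a b) (GraphDefs.InSub G T)) where
  open GraphDefs G
  open Walks G
  open WeightedWalks G wt wt≥0
  open import Data.List.Membership.DecPropositional (_≟ᶠ_ {m}) using () renaming (_∈?_ to _∈ₑ?_)

  κ : ℚ
  κ = 1ℚ + ε

  distIn : ∀ H → T ⊆ H → ∀ a b → Σ ℚ (IsDist wt H a b)
  distIn H T⊆H a b = let (W , W-in-T) = T-connected a b in distance (_∈ₛ? H) W (All.map T⊆H W-in-T)

  ⊆-addSub : ∀ {H e} → H ⊆ addSub H e
  ⊆-addSub {H} {e} = Subset.p⊆p∪q ⁅ e ⁆

  ∈-addSub : ∀ {H} e → e ∈ₛ addSub H e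
  ∈-addSub {H} e = Subset.q⊆p∪q H ⁅ e ⁆ (Subset.x∈⁅x⁆ e)

  ∈-addSub⁻ : ∀ {H e x} → x ∈ₛ addSub H e → x ∈ₛ H ⊎ x ≡ e
  ∈-addSub⁻ {H} {e} x∈ with Subset.x∈p∪q⁻ H ⁅ e ⁆ x∈
  ... | inj₁ x∈H = inj₁ x∈H
  ... | inj₂ x∈e = inj₂ (Subset.x∈⁅y⁆⇒x≡y e x∈e)

  InSub-addSub⁻ : ∀ {H e a b} (W : Walk a b) → InSub (addSub H e) W → e ∉ edgesOf W → InSub H W
  InSub-addSub⁻ W inW e∉W = All.tabulate λ {x} x∈W → case ∈-addSub⁻ (All.lookup inW x∈W) of λ
    { (inj₁ x∈H)  → x∈H
    ; (inj₂ refl) → contradiction x∈W e∉W }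

  Greedy-⊆ : ∀ {H es H′} → Greedy wt ε H es H′ → H ⊆ H′
  Greedy-⊆ done       = id
  Greedy-⊆ (add _ g)  = Greedy-⊆ g ∘ ⊆-addSub
  Greedy-⊆ (skip _ g) = Greedy-⊆ g

  Stretched : Subset m → Edge → Set
  Stretched H e = Σ (EndWalk e) λ W → InSub H W × weight W ≤ κ * wt e

  wt≤κ*wt : ∀ e → wt e ≤ κ * wt e
  wt≤κ*wt e = begin
    wt e                 ≡⟨ sym (ℚ.+-identityʳ (wt e)) ⟩
    wt e + 0ℚ            ≤⟨ ℚ.+-monoʳ-≤ (wt e) (0≤*0≤⇒0≤ ε≥0 (wt≥0 e)) ⟩
    wt e + ε * wt e      ≡⟨ cong (_+ ε * wt e) (sym (ℚ.*-identityˡ (wt e))) ⟩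
    1ℚ * wt e + ε * wt e ≡⟨ sym (ℚ.*-distribʳ-+ (wt e) 1ℚ ε) ⟩
    κ * wt e ∎
    where open ℚ.≤-Reasoning

  ∈⇒Stretched : ∀ {H e} → e ∈ₛ H → Stretched H e
  ∈⇒Stretched {e = e} e∈H = edgeWalk e , e∈H ∷ [] , ℚ.≤-trans (ℚ.≤-reflexive (weight-edgeWalk e)) (wt≤κ*wt e)

  -- A skipped edge fails the test, so its ends are already at distance at most (1+ε) w(e).
  greedy-stretches : ∀ {H es H′} → T ⊆ H → Greedy wt ε H es H′ → ∀ {e} → e ∈ es → Stretched H′ e
  greedy-stretches T⊆H (add _ g)  (here refl) = ∈⇒Stretched (Greedy-⊆ g (∈-addSub _))
  greedy-stretches T⊆H (add _ g)  (there e∈)  = greedy-stretches (⊆-addSub ∘ T⊆H) g e∈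
  greedy-stretches T⊆H (skip _ g) (there e∈)  = greedy-stretches T⊆H g e∈
  greedy-stretches {H} T⊆H (skip ¬test g) {e} (here refl)
    with distIn H T⊆H (proj₁ (ends e)) (proj₂ (ends e))
  ... | d , isDist@((W , inW , W≡d) , _) with κ * wt e ℚ.<? d
  ...   | yes κw<d =
    contradiction (λ d′ isDist′ → subst (κ * wt e <_) (IsDistWithin-unique isDist isDist′) κw<d) ¬test
  ...   | no  κw≮d = W , All.map (Greedy-⊆ g) inW , ℚ.≤-trans (ℚ.≤-reflexive W≡d) (ℚ.≮⇒≥ κw≮d)

  stretched⇒spanner : ∀ {H} → (∀ e → Stretched H e) → IsSpanner wt ε H
  stretched⇒spanner {H} stretched a b dG ((W , _ , W≡dG) , _) =
    dH , isDist , ℚ.≤-trans (proj₂ isDist V inV) V≤κdG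
    where
    V = substitute W (λ {h} _ → proj₁ (stretched h))
    inV : InSub H V
    inV = All-substitute W _ (λ {h} _ → proj₁ (proj₂ (stretched h)))
    V≤κdG : weight V ≤ κ * dG
    V≤κdG = begin
      weight V
        ≤⟨ weight-substitute-≤ (λ h → κ * wt h) W _ (λ {h} _ → proj₂ (proj₂ (stretched h))) ⟩
      ∑[ edgesOf W ] (λ h → κ * wt h)
        ≡⟨ sym (*-distribˡ-∑ κ wt (edgesOf W)) ⟩
      κ * weight W
        ≡⟨ cong (κ *_) W≡dG ⟩
      κ * dG ∎
      where open ℚ.≤-Reasoning
    dH = proj₁ (distance (_∈ₛ? H) V inV)
    isDist = proj₂ (distance (_∈ₛ? H) V inV)

  NoShortDetour : Subset m → Set
  NoShortDetour H = ∀ e → e ∈ₛ H → e ∉ₛ T → ∀ (P : EndWalk e) → IsPath P → InSub H P → e ∉ edgesOf P →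
    κ * wt e < weight P

  NoShortDetour⇒walk : ∀ {H} → NoShortDetour H → ∀ e → e ∈ₛ H → e ∉ₛ T → ∀ (W : EndWalk e) →
    InSub H W → e ∉ edgesOf W → κ * wt e < weight W
  NoShortDetour⇒walk noShort e e∈H e∉T W inW e∉W with eraseLoops W
  ... | P , isPath-P , P⊆W =
    ℚ.<-≤-trans (noShort e e∈H e∉T P isPath-P (All-resp-⊆ P⊆W inW) (e∉W ∘ Sublist.lookup P⊆W))
                (weight-⊆ P W P⊆W)

  record SplitAt (e : Edge) {a b} (W : Walk a b) : Set where
    field
      {s t}   : Vertex
      before  : Walk a s
      via     : Joins e s t
      after   : Walk t b
      edges≡  : edgesOf W ≡ edgesOf before ++ e ∷ edgesOf after
      ∉before : e ∉ edgesOf before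
      ∉after  : e ∉ edgesOf after

  splitAt : ∀ {e a b} (W : Walk a b) → Unique (edgesOf W) → e ∈ edgesOf W → SplitAt e W
  splitAt (step f j W) (f∉W ∷ _) (here refl) = record
    { before = [] ; via = j ; after = W ; edges≡ = refl
    ; ∉before = λ () ; ∉after = λ e∈W → All.lookup f∉W e∈W refl }
  splitAt {e} (step f j W) (f∉W ∷ unique) (there e∈W) = record
    { before = step f j before ; via = via ; after = after ; edges≡ = cong (f ∷_) edges≡
    ; ∉before = λ { (here refl) → All.lookup f∉W e∈W refl ; (there e∈) → ∉before e∈ }
    ; ∉after = ∉after }
    where open SplitAt (splitAt W unique e∈W)

  κ-mono : ∀ {p q} → p ≤ q → κ * p ≤ κ * q
  κ-mono = 0≤⇒*-monoˡ-≤ (ℚ.+-mono-≤ (ℚ.<⇒≤ (ℚ.positive⁻¹ 1ℚ)) ε≥0)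

  -- Going around P the other way through e connects the ends of e′ inside H, and the test passed for e′.
  detour-through-added : ∀ {H e′} → T ⊆ H → AddCond wt ε H e′ → ∀ {e} → e ∈ₛ H → wt e ≤ wt e′ →
    (P : EndWalk e) → IsPath P → InSub (addSub H e′) P → e′ ∈ edgesOf P → κ * wt e < weight P
  detour-through-added {H} {e′} T⊆H test {e} e∈H we≤we′ P isPath-P inP e′∈P = begin-strict
    κ * wt e                                         ≤⟨ κ-mono we≤we′ ⟩
    κ * wt e′                                        <⟨ test d isDist ⟩
    d                                                ≤⟨ proj₂ isDist around around-in-H ⟩
    weight around                                    ≡⟨ weight-around ⟩
    weight before + (wt e + weight after)            ≤⟨ ℚ.+-monoʳ-≤ (weight before) (ℚ.+-monoˡ-≤ _ we≤we′) ⟩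
    weight before + (wt e′ + weight after)           ≡⟨ weight-P ⟩
    weight P ∎
    where
    open ℚ.≤-Reasoning
    open SplitAt (splitAt P (IsPath⇒Unique-edges P isPath-P) e′∈P)
    d = proj₁ (distIn H T⊆H (proj₁ (ends e′)) (proj₂ (ends e′)))
    isDist = proj₂ (distIn H T⊆H (proj₁ (ends e′)) (proj₂ (ends e′)))
    inP-parts : InSub (addSub H e′) before × InSub (addSub H e′) after
    inP-parts = let inP′ = subst (All _) edges≡ inP in
      All.++⁻ˡ (edgesOf before) inP′ , All.tail (All.++⁻ʳ (edgesOf before) inP′)
    around : EndWalk e′
    around = retrace via (rev before ▸ step e (inj₁ refl) (rev after))
    around-in-H : InSub H around
    around-in-H = All-retrace via _ (All-▸ (rev before) _
      (All-rev before (InSub-addSub⁻ before (proj₁ inP-parts) ∉before))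
      (e∈H ∷ All-rev after (InSub-addSub⁻ after (proj₂ inP-parts) ∉after)))
    weight-around : weight around ≡ weight before + (wt e + weight after)
    weight-around = trans (weight-retrace via _) (trans (weight-▸ (rev before) _)
      (cong₂ _+_ (weight-rev before) (cong (wt e +_) (weight-rev after))))
    weight-P : weight before + (wt e′ + weight after) ≡ weight P
    weight-P = sym (trans (cong (∑[_] wt) edges≡) (∑-++ wt (edgesOf before) (e′ ∷ edgesOf after)))

  NoShortDetour-addSub : ∀ {H e′} → T ⊆ H → NoShortDetour H → (∀ e → e ∈ₛ H → e ∉ₛ T → wt e ≤ wt e′) →
    AddCond wt ε H e′ → NoShortDetour (addSub H e′)
  NoShortDetour-addSub {H} {e′} T⊆H noShort lighter test e e∈ e∉T P isPath-P inP e∉P with ∈-addSub⁻ e∈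
  ... | inj₂ refl = let (d , isDist) = distIn H T⊆H (proj₁ (ends e)) (proj₂ (ends e)) in
    ℚ.<-≤-trans (test d isDist) (proj₂ isDist P (InSub-addSub⁻ P inP e∉P))
  ... | inj₁ e∈H with e′ ∈ₑ? edgesOf P
  ...   | no  e′∉P = noShort e e∈H e∉T P isPath-P (InSub-addSub⁻ P inP e′∉P) e∉P
  ...   | yes e′∈P = detour-through-added T⊆H test e∈H (lighter e e∈H e∉T) P isPath-P inP e′∈P

  -- Edges are processed by nondecreasing weight, so an added edge is at least as heavy
  -- as the non-tree edges added before it.
  greedy-NoShortDetour : ∀ {H es H′} → T ⊆ H → NoShortDetour H →
    (∀ e → e ∈ₛ H → e ∉ₛ T → All (λ f → wt e ≤ wt f) es) → AllPairs (λ e f → wt e ≤ wt f) es →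
    Greedy wt ε H es H′ → NoShortDetour H′
  greedy-NoShortDetour T⊆H noShort lighter sorted done = noShort
  greedy-NoShortDetour {H} T⊆H noShort lighter (e′≤es ∷ sorted) (add {e = e′} test g) =
    greedy-NoShortDetour (⊆-addSub ∘ T⊆H)
      (NoShortDetour-addSub T⊆H noShort (λ e e∈H e∉T → All.head (lighter e e∈H e∉T)) test)
      lighter′ sorted g
    where
    lighter′ : ∀ e → e ∈ₛ addSub H e′ → e ∉ₛ T → All _ _
    lighter′ e e∈ e∉T with ∈-addSub⁻ e∈
    ... | inj₁ e∈H  = All.tail (lighter e e∈H e∉T)
    ... | inj₂ refl = e′≤es
  greedy-NoShortDetour T⊆H noShort lighter (_ ∷ sorted) (skip _ g) =
    greedy-NoShortDetour T⊆H noShort (λ e e∈H e∉T → All.tail (lighter e e∈H e∉T)) sorted g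

module Potential (G : Graph) (wt : GraphDefs.Weighting G) (wt≥0 : ∀ e → 0ℚ ≤ wt e)
                 (ε : ℚ) (ε≥0 : 0ℚ ≤ ε) (T : Subset (Graph.m G))
                 (T-connected : ∀ a b → Σ (GraphDefs.Walk G a b) (GraphDefs.InSub G T))
                 {v S} (scheme : GraphDefs.AcyclicChargingScheme G T v S)
                 {H : Subset (Graph.m G)} (T⊆H : T ⊆ H) where
  open GraphDefs G
  open Walks G
  open WeightedWalks G wt wt≥0
  open GreedyRun G wt wt≥0 ε ε≥0 T T-connected
  open Charging G
  open AcyclicChargingScheme scheme

  rank : Edge → ℕ
  rank = proj₁ ordering

  rank-increases : ∀ en → en ∈ S → 0ℚ < amount en → ∀ {h} → h ∈ edgesOf (path en) → rank (edge en) ℕ.< rank h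
  rank-increases en en∈S 0<a h∈ = proj₂ (proj₂ ordering) en en∈S 0<a _ h∈

  -- Recursion towards higher rank terminates because Fin m is finite.
  higherRank-wellFounded : WellFounded (λ h f → rank f ℕ.< rank h)
  higherRank-wellFounded =
    spo-wellFounded (On.isStrictPartialOrder rank (Flip.isStrictPartialOrder ℕ.<-isStrictPartialOrder))

  positive-entry : ∀ f → f ∉ₛ T → ∃ λ en → en ∈ S × edge en ≡ f × 0ℚ < amount en
  positive-entry f f∉T
    with ∑-pos⇒∃ amount (filter (λ en → edge en ≟ᶠ f) S) (ℚ.<-≤-trans (ℚ.positive⁻¹ 1ℚ) (out≥1 f f∉T))
  ... | en , en∈ , 0<a =
    let (en∈S , edge≡f) = ∈-filter⁻ (λ en → edge en ≟ᶠ f) {xs = S} en∈ in en , en∈S , edge≡f , 0<a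

  RankAbove : Edge → Edge → Set
  RankAbove f h = h ∈ₛ H × rank f ℕ.≤ rank h

  upward-walk : ∀ f → Acc (λ h f → rank f ℕ.< rank h) f → Σ (EndWalk f) λ W → All (RankAbove f) (edgesOf W)
  upward-walk f _ with f ∈ₛ? H
  upward-walk f _        | yes f∈H = edgeWalk f , (f∈H , ℕ.≤-refl) ∷ []
  upward-walk f (acc rs) | no  f∉H with positive-entry f (f∉H ∘ T⊆H)
  ... | en , en∈S , refl , 0<a =
    substitute (path en) (λ h∈ → proj₁ (upward-walk _ (rs (rank-increases en en∈S 0<a h∈)))) ,
    All-substitute (path en) _ λ h∈ → All.map (λ (g∈H , h≤g) → g∈H , ℕ.≤-trans (ℕ.<⇒≤ (rank-increases en en∈S 0<a h∈)) h≤g)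
                                               (proj₂ (upward-walk _ (rs (rank-increases en en∈S 0<a h∈))))

  RankAbove? : ∀ f → Decidable (RankAbove f)
  RankAbove? f h = (h ∈ₛ? H) ×-dec (rank f ℕ.≤? rank h)

  shortest-upward : ∀ f → Σ ℚ (IsDistWithin (RankAbove f) (proj₁ (ends f)) (proj₂ (ends f)))
  shortest-upward f = let (W , upW) = upward-walk f (higherRank-wellFounded f) in distance (RankAbove? f) W upW

  -- Only edges of no lower rank are allowed, so that the potential walks of the edges
  -- of a charged path avoid the charging edge.
  potential : Edge → ℚ
  potential f with f ∈ₛ? H
  ... | yes _ = wt f
  ... | no  _ = proj₁ (shortest-upward f)

  potential-∈ : ∀ {f} → f ∈ₛ H → potential f ≡ wt f
  potential-∈ {f} f∈H with f ∈ₛ? H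
  ... | yes _   = refl
  ... | no  f∉H = contradiction f∈H f∉H

  potential-≤ : ∀ {f} → f ∉ₛ H → ∀ (W : EndWalk f) → All (RankAbove f) (edgesOf W) → potential f ≤ weight W
  potential-≤ {f} f∉H W upW with f ∈ₛ? H
  ... | yes f∈H = contradiction f∈H f∉H
  ... | no  _   = proj₂ (proj₂ (shortest-upward f)) W upW

  potential-walk : ∀ f → Σ (EndWalk f) λ W → All (RankAbove f) (edgesOf W) × weight W ≤ potential f
  potential-walk f with f ∈ₛ? H
  ... | yes f∈H = edgeWalk f , (f∈H , ℕ.≤-refl) ∷ [] , ℚ.≤-reflexive (weight-edgeWalk f)
  ... | no  _   = let ((W , upW , W≡d) , _) = proj₂ (shortest-upward f) in W , upW , ℚ.≤-reflexive W≡d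

  potential-nonNeg : ∀ f → 0ℚ ≤ potential f
  potential-nonNeg f = let (W , _ , W≤) = potential-walk f in ℚ.≤-trans (weight-nonNeg W) W≤

  detour-walk : ∀ en → en ∈ S → 0ℚ < amount en →
    Σ (EndWalk (edge en)) λ W →
      All (λ h → h ∈ₛ H × rank (edge en) ℕ.< rank h) (edgesOf W) × weight W ≤ pathCost potential en
  detour-walk en en∈S 0<a =
    substitute (path en) (λ {h} _ → proj₁ (potential-walk h)) ,
    All-substitute (path en) _ (λ {h} h∈ → All.map (λ (g∈H , h≤g) → g∈H , ℕ.<-≤-trans (rank-increases en en∈S 0<a h∈) h≤g)
                                                   (proj₁ (proj₂ (potential-walk h)))) ,
    weight-substitute-≤ potential (path en) _ (λ {h} _ → proj₂ (proj₂ (potential-walk h)))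

  NonTree? : ∀ f → Dec (f ∈ₛ H × f ∉ₛ T)
  NonTree? f = (f ∈ₛ? H) ×-dec ¬? (f ∈ₛ? T)

  excess : Edge → ℚ
  excess f = (ε * wt f) when NonTree? f

  excess-≤ : NoShortDetour H → ∀ en → en ∈ S → 0ℚ < amount en →
    excess (edge en) ≤ pathCost potential en - potential (edge en)
  excess-≤ noShort en en∈S 0<a = by-membership (edge en ∈ₛ? H)
    where
    e = edge en
    W = proj₁ (detour-walk en en∈S 0<a)
    upW = proj₁ (proj₂ (detour-walk en en∈S 0<a))
    W≤cost = proj₂ (proj₂ (detour-walk en en∈S 0<a))
    by-membership : Dec (e ∈ₛ H) → excess e ≤ pathCost potential en - potential e
    by-membership (yes e∈H) = begin
      excess e                            ≡⟨ when-yes (NonTree? e) (e∈H , e∉T) ⟩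
      ε * wt e                            ≡⟨ solve 2 (λ ε w → ε :* w := (con 1ℚ :+ ε) :* w :- w) refl ε (wt e) ⟩
      κ * wt e - wt e                     ≤⟨ ℚ.+-monoˡ-≤ (- wt e) (ℚ.<⇒≤ (ℚ.<-≤-trans κw<W W≤cost)) ⟩
      pathCost potential en - wt e        ≡⟨ cong (λ p → pathCost potential en - p) (sym (potential-∈ e∈H)) ⟩
      pathCost potential en - potential e ∎
      where
      open ℚ.≤-Reasoning
      e∉T = onlyNonT en en∈S 0<a
      κw<W : κ * wt e < weight W
      κw<W = NoShortDetour⇒walk noShort e e∈H e∉T W (All.map proj₁ upW)
                                (λ e∈W → ℕ.<-irrefl refl (proj₂ (All.lookup upW e∈W)))
    by-membership (no e∉H) = ℚ.≤-trans (ℚ.≤-reflexive (when-no (NonTree? e) (λ (e∈H , _) → e∉H e∈H)))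
      (≤⇒0≤- (ℚ.≤-trans (potential-≤ e∉H W (All.map (λ (g∈H , e<g) → g∈H , ℕ.<⇒≤ e<g) upW)) W≤cost))

  nonTreeWeight : ℚ
  nonTreeWeight = ∑[ allFin m ] (λ f → wt f when NonTree? f)

  subWeight-split : subWeight wt H ≡ subWeight wt T + nonTreeWeight
  subWeight-split = begin
    subWeight wt H
      ≡⟨ ∑-filter (_∈ₛ? H) wt (allFin m) ⟩
    ∑[ allFin m ] (λ f → wt f when (f ∈ₛ? H))
      ≡⟨ ∑-cong (allFin m) (λ {f} _ → split f (f ∈ₛ? H) (f ∈ₛ? T)) ⟩
    ∑[ allFin m ] (λ f → wt f when (f ∈ₛ? T) + wt f when NonTree? f)
      ≡⟨ ∑-+ _ _ (allFin m) ⟩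
    ∑[ allFin m ] (λ f → wt f when (f ∈ₛ? T)) + nonTreeWeight
      ≡⟨ cong (_+ nonTreeWeight) (sym (∑-filter (_∈ₛ? T) wt (allFin m))) ⟩
    subWeight wt T + nonTreeWeight ∎
    where
    open ≡-Reasoning
    split : ∀ f (dH : Dec (f ∈ₛ H)) (dT : Dec (f ∈ₛ T)) →
      wt f when dH ≡ wt f when dT + wt f when (dH ×-dec ¬? dT)
    split f (yes _)   (yes _)   = sym (ℚ.+-identityʳ (wt f))
    split f (yes _)   (no _)    = sym (ℚ.+-identityˡ (wt f))
    split f (no f∉H)  (yes f∈T) = contradiction (T⊆H f∈T) f∉H
    split f (no _)    (no _)    = refl

  nonTreeWeight-bound : NoShortDetour H → ε * nonTreeWeight ≤ v * subWeight wt T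
  nonTreeWeight-bound noShort = begin
    ε * nonTreeWeight
      ≡⟨ trans (*-distribˡ-∑ ε _ (allFin m)) (∑-cong (allFin m) (λ {f} _ → *-when (NonTree? f) ε (wt f))) ⟩
    ∑[ allFin m ] excess
      ≤⟨ charging-bound scheme potential excess potential-nonNeg
           (λ f → when-nonNeg (NonTree? f) (0≤*0≤⇒0≤ ε≥0 (wt≥0 f)))
           (λ f f∈T → when-no (NonTree? f) (λ (_ , f∉T) → f∉T f∈T))
           (excess-≤ noShort) ⟩
    v * ∑[ allFin m ] (λ f → potential f when (f ∈ₛ? T))
      ≡⟨ cong (v *_) (trans (∑-cong (allFin m) (λ {f} _ → potential-on-T f (f ∈ₛ? T)))
                            (sym (∑-filter (_∈ₛ? T) wt (allFin m)))) ⟩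
    v * subWeight wt T ∎
    where
    open ℚ.≤-Reasoning
    potential-on-T : ∀ f (d : Dec (f ∈ₛ T)) → potential f when d ≡ wt f when d
    potential-on-T f (yes f∈T) = potential-∈ (T⊆H f∈T)
    potential-on-T f (no _)    = refl

≤-from-split : ∀ {a x} b v ε .{{_ : Positive ε}} → a ≡ b + x → ε * x ≤ v * b →
  a ≤ (1ℚ + _÷_ v ε {{pos⇒nonZero ε}}) * b
≤-from-split {a} {x} b v ε a≡b+x εx≤vb = begin
  a                   ≡⟨ a≡b+x ⟩
  b + x               ≤⟨ ℚ.+-monoʳ-≤ b x≤qb ⟩
  b + q * b           ≡⟨ solve 2 (λ b q → b :+ q :* b := (con 1ℚ :+ q) :* b) refl b q ⟩
  (1ℚ + q) * b ∎
  where
  open ℚ.≤-Reasoning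
  instance _ = pos⇒nonZero ε
  q = v ÷ ε
  ε*q*b≡v*b : ε * (q * b) ≡ v * b
  ε*q*b≡v*b = trans
    (solve 4 (λ ε v r b → ε :* ((v :* r) :* b) := (ε :* r) :* (v :* b)) refl ε v (1/ ε) b)
    (trans (cong (_* (v * b)) (ℚ.*-inverseʳ ε)) (ℚ.*-identityˡ (v * b)))
  x≤qb : x ≤ q * b
  x≤qb = ℚ.*-cancelˡ-≤-pos ε (ℚ.≤-trans εx≤vb (ℚ.≤-reflexive (sym ε*q*b≡v*b)))

theorem2 : (G : Graph) → let open GraphDefs G in
    (T : Subset m) → IsSpanningTree T →
    (v : ℚ) (S : Scheme) → AcyclicChargingScheme T v S →
    (ε : ℚ) .{{_ : Positive ε}} →
    (w : Weighting) → (∀ e → 0ℚ ≤ w e) →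
    (order : List Edge) → GreedyOrder w T order →
    (G' : Subset m) → Greedy w ε T order G' →
    T ⊆ G' × IsSpanner w ε G'
      × subWeight w G' ≤ (1ℚ + _÷_ v ε {{pos⇒nonZero ε}}) * subWeight w T
theorem2 G T (T-connected , _) v S scheme ε w w≥0 order (_ , lists-non-tree , sorted) G′ run =
  T⊆G′ , stretched⇒spanner stretched ,
  ≤-from-split (subWeight w T) v ε subWeight-split (nonTreeWeight-bound noShortDetour)
  where
  open GraphDefs G
  open GreedyRun G w w≥0 ε (ℚ.<⇒≤ (ℚ.positive⁻¹ ε)) T T-connected
  T⊆G′ = Greedy-⊆ run
  open Potential G w w≥0 ε (ℚ.<⇒≤ (ℚ.positive⁻¹ ε)) T T-connected scheme T⊆G′
  stretched : ∀ e → Stretched G′ e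
  stretched e with e ∈ₛ? T
  ... | yes e∈T = ∈⇒Stretched (T⊆G′ e∈T)
  ... | no  e∉T = greedy-stretches id run (proj₂ (lists-non-tree e) e∉T)
  noShortDetour : NoShortDetour G′
  noShortDetour = greedy-NoShortDetour id (λ _ e∈T e∉T → contradiction e∈T e∉T)
                                          (λ _ e∈T e∉T → contradiction e∈T e∉T) sorted run
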